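{- Let $u$ be a rational number with $u\neq0,\pm1,\pm3$, and let $r=\frac{2u}{3-u^2}$, $s=\frac{u^4-9}{8u^2}$. Define $$a=\frac{(u^4+2u^2+9)^2(u^2-1)(u^2-9)}{64(u^2-3)^2u^4},\quad b=-\frac{64(u^4-2u^2+9)u^4}{(u^4+2u^2+9)^2(u^2-3)^2},$$ $$c=\frac{(u^8+46u^4+81)(u^2+9)(u^2+1)(u^2-3)^2}{64(u^4+2u^2+9)^2u^4}.$$ Then $a=s^2-r^2$, $b=\frac{r^4-1}{a}$, $c=\frac{s^4-1}{a}$, and $(a,b,c)$ is a quartic Diophantine triple.
   Context: A quartic Diophantine triple is a triple $(a,b,c)$ of distinct nonzero rational numbers such that $ab+1$, $ac+1$ and $bc+1$ are all fourth powers of rational numbers. -}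

module Defs where

open import Data.Nat.Base using (ℕ; zero; suc)
open import Data.Rational.Base using (ℚ; 0ℚ; 1ℚ; _+_; _*_; _-_; -_; _÷_; ≢-nonZero)
open import Data.Rational.Properties using (_≟_)
import Data.Rational.Literals as Lit
import Data.Nat.Literals as NLit
open import Agda.Builtin.FromNat
open import Agda.Builtin.FromNeg
open import Data.Product using (Σ; _×_)
open import Relation.Binary.PropositionalEquality using (_≡_; _≢_)
open import Relation.Nullary using (yes; no)
open import Data.Unit.Base public using (tt)

instance
  ℕ-number : Number ℕ
  ℕ-number = NLit.number
  ℚ-number : Number ℚ
  ℚ-number = Lit.number
  ℚ-negative : Negative ℚ
  ℚ-negative = Lit.negative

infixr 8 _^_
_^_ : ℚ → ℕ → ℚ
x ^ zero  = 1ℚ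
x ^ suc n = x * x ^ n

-- Total division with the convention p ⊘ 0 = 0.  In the theorem every
-- denominator is nonzero under the hypotheses, so the convention is never used.
infixl 7 _⊘_
_⊘_ : ℚ → ℚ → ℚ
p ⊘ q with q ≟ 0ℚ
... | yes _  = 0ℚ
... | no q≢0 = _÷_ p q {{≢-nonZero q≢0}}

IsFourthPower : ℚ → Set
IsFourthPower x = Σ ℚ (λ y → x ≡ y ^ 4)

QuarticDiophantineTriple : ℚ → ℚ → ℚ → Set
QuarticDiophantineTriple a b c =
  (a ≢ b × a ≢ c × b ≢ c) ×
  (a ≢ 0ℚ × b ≢ 0ℚ × c ≢ 0ℚ) ×
  (IsFourthPower (a * b + 1ℚ) × IsFourthPower (a * c + 1ℚ) × IsFourthPower (b * c + 1ℚ))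

r : ℚ → ℚ
r u = (2 * u) ⊘ (3 - u ^ 2)

s : ℚ → ℚ
s u = (u ^ 4 - 9) ⊘ (8 * u ^ 2)

a : ℚ → ℚ
a u = ((u ^ 4 + 2 * u ^ 2 + 9) ^ 2 * (u ^ 2 - 1) * (u ^ 2 - 9))
      ⊘ (64 * (u ^ 2 - 3) ^ 2 * u ^ 4)

b : ℚ → ℚ
b u = - ((64 * (u ^ 4 - 2 * u ^ 2 + 9) * u ^ 4)
         ⊘ ((u ^ 4 + 2 * u ^ 2 + 9) ^ 2 * (u ^ 2 - 3) ^ 2))

c : ℚ → ℚ
c u = ((u ^ 8 + 46 * u ^ 4 + 81) * (u ^ 2 + 9) * (u ^ 2 + 1) * (u ^ 2 - 3) ^ 2)
      ⊘ (64 * (u ^ 4 + 2 * u ^ 2 + 9) ^ 2 * u ^ 4)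

{-# OPTIONS --safe #-}

-- With a = s² − r², b = (r⁴ − 1)/a and c = (s⁴ − 1)/a one has ab + 1 = r⁴ and ac + 1 = s⁴ for
-- any r, s with s² ≠ r²; the parametrisation by u is chosen so that also bc + 1 = w⁴ with
-- w = 2u(u² − 3)/(u⁴ + 2u² + 9).  Each identity is checked by writing both sides as quotients of
-- polynomials in u and cross-multiplying, which leaves a polynomial identity for the ring solver;
-- the denominators vanish only at u = 0 or u² = 3, and √3 is irrational.  Finally b < 0 < c, and
-- the cross-multiplied numerators of a − b and c − a factor as (u² − 3)⁶ G and 2¹⁵ u¹⁰ H with G, H
-- positive sums of squares.

module Submission where

open import Defs
open import Agda.Builtin.FromNat
open import Agda.Builtin.FromNeg
open import Data.Rational.Base using (ℚ; 0ℚ; 1ℚ; _-_; -_)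
open import Data.Product using (_×_)
open import Relation.Binary.PropositionalEquality using (_≡_; _≢_)

open import Algebra.Bundles using (CommutativeMonoid)
open import Data.Nat.Base as ℕ using (ℕ; zero; suc)
import Data.Nat.Properties as ℕ
open import Data.Nat.Coprimality using (Coprime; coprime?)
open import Data.Nat.Divisibility using (_∣_; divides)
open import Data.Nat.Primality using (Prime; prime?; euclidsLemma; ¬prime[1]; prime⇒nonZero)
import Data.Nat.Tactic.RingSolver as ℕ-Solver
import Data.Integer.Base as ℤ
import Data.Integer.Properties as ℤ
open import Data.Product using (_,_)
open import Data.Rational.Base
  using (NonZero; NonNegative; Positive; _+_; _*_; 1/_; _≤_; _<_; mkℚ; ≢-nonZero;
         positive; negative; nonNegative; nonPositive)
import Data.Rational.Properties as ℚ
open import Data.Rational.Properties using (_≟_)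
open import Data.Rational.Solver using (module +-*-Solver)
import Data.Rational.Unnormalised.Base as ℚᵘ
import Data.Rational.Unnormalised.Properties as ℚᵘ
open import Data.Sum using (_⊎_; inj₁; inj₂; [_,_]′) renaming (map to ⊎-map)
open import Function using (id; _∘_)
open import Relation.Binary.PropositionalEquality
  using (refl; sym; trans; cong; cong₂; subst; subst₂; ≢-sym; module ≡-Reasoning)
open import Relation.Binary.Definitions using (tri<; tri≈; tri>)
open import Relation.Nullary using (yes; no; contradiction)
open import Relation.Nullary.Decidable using (from-yes; recompute)

open import Algebra.Properties.Group ℚ.+-0-group using (x∙y⁻¹≈ε⇒x≈y; inverseˡ-unique)
open import Algebra.Properties.CommutativeSemigroup
  (CommutativeMonoid.commutativeSemigroup ℚ.*-1-commutativeMonoid) using (interchange)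
open +-*-Solver
open ≡-Reasoning

x²≡x*x : ∀ x → x ^ 2 ≡ x * x
x²≡x*x x = cong (x *_) (ℚ.*-identityʳ x)

p*q*1/q≡p : ∀ p q .{{_ : NonZero q}} → p * q * 1/ q ≡ p
p*q*1/q≡p p q = trans (ℚ.*-assoc p q (1/ q)) (trans (cong (p *_) (ℚ.*-inverseʳ q)) (ℚ.*-identityʳ p))

*-cancelʳ-≡ : ∀ {p r} q → q ≢ 0ℚ → p * q ≡ r * q → p ≡ r
*-cancelʳ-≡ {p} {r} q q≢0 eq = begin
  p             ≡⟨ p*q*1/q≡p p q ⟨
  p * q * 1/ q  ≡⟨ cong (_* 1/ q) eq ⟩
  r * q * 1/ q  ≡⟨ p*q*1/q≡p r q ⟩
  r             ∎
  where instance _ = ≢-nonZero q≢0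

p*q≡0⇒p≡0∨q≡0 : ∀ p {q} → p * q ≡ 0ℚ → p ≡ 0ℚ ⊎ q ≡ 0ℚ
p*q≡0⇒p≡0∨q≡0 p {q} eq with p ≟ 0ℚ
... | yes p≡0 = inj₁ p≡0
... | no  p≢0 = inj₂ (*-cancelʳ-≡ p p≢0 (trans (ℚ.*-comm q p) (trans eq (sym (ℚ.*-zeroˡ p)))))

*-≢0 : ∀ {p q} → p ≢ 0ℚ → q ≢ 0ℚ → p * q ≢ 0ℚ
*-≢0 {p} p≢0 q≢0 = [ p≢0 , q≢0 ]′ ∘ p*q≡0⇒p≡0∨q≡0 p

^-≢0 : ∀ {p} n → p ≢ 0ℚ → p ^ n ≢ 0ℚ
^-≢0 zero    p≢0 ()
^-≢0 (suc n) p≢0 = *-≢0 p≢0 (^-≢0 n p≢0)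

p-q≡0⇒p≡q : ∀ {p q} → p - q ≡ 0ℚ → p ≡ q
p-q≡0⇒p≡q {p} {q} = x∙y⁻¹≈ε⇒x≈y p q

x²≡y²⇒x≡±y : ∀ {x y} → x ^ 2 ≡ y ^ 2 → x ≡ y ⊎ x ≡ - y
x²≡y²⇒x≡±y {x} {y} eq = ⊎-map p-q≡0⇒p≡q (inverseˡ-unique x y) (p*q≡0⇒p≡0∨q≡0 (x - y) (begin
  (x - y) * (x + y)  ≡⟨ solve 2 (λ x y → (x :- y) :* (x :+ y) := x :^ 2 :- y :^ 2) (λ {_ _} → refl) x y ⟩
  x ^ 2 - y ^ 2      ≡⟨ cong (_- y ^ 2) eq ⟩
  y ^ 2 - y ^ 2      ≡⟨ ℚ.+-inverseʳ (y ^ 2) ⟩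
  0ℚ                 ∎))

p≡q-1⇒p+1≡q : ∀ {p q} → p ≡ q - 1ℚ → p + 1ℚ ≡ q
p≡q-1⇒p+1≡q {p} {q} refl = begin
  q - 1ℚ + 1ℚ       ≡⟨ ℚ.+-assoc q (- 1ℚ) 1ℚ ⟩
  q + (- 1ℚ + 1ℚ)   ≡⟨ ℚ.+-identityʳ q ⟩
  q                 ∎

-- Irrationality of square roots of primes

module _ {p : ℕ} (p-prime : Prime p) where

  prime∣square⇒prime∣ : ∀ {m} n → m ℕ.* m ≡ p ℕ.* n → p ∣ m
  prime∣square⇒prime∣ {m} n eq =
    [ id , id ]′ (euclidsLemma m m p-prime (divides n (trans eq (ℕ.*-comm p n))))

  square≢prime*square : ∀ m n → Coprime m n → m ℕ.* m ≢ p ℕ.* (n ℕ.* n)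
  square≢prime*square m n coprime eq with prime∣square⇒prime∣ {m} (n ℕ.* n) eq
  ... | p∣m@(divides k refl) = ¬prime[1] (subst Prime (coprime (p∣m , p∣n)) p-prime)
    where
    instance _ = prime⇒nonZero p-prime
    square-of-multiple : ∀ k m → k ℕ.* m ℕ.* (k ℕ.* m) ≡ m ℕ.* (m ℕ.* (k ℕ.* k))
    square-of-multiple = ℕ-Solver.solve-∀
    p∣n : p ∣ n
    p∣n = prime∣square⇒prime∣ (k ℕ.* k)
      (ℕ.*-cancelˡ-≡ (n ℕ.* n) (p ℕ.* (k ℕ.* k)) p (trans (sym eq) (square-of-multiple k p)))

  -- Writing x = n / (1 + d-1) in lowest terms, x² = p says n · n · 1 = p · (1 + d-1)² in ℤ.
  square≢prime : ∀ x → x ^ 2 ≢ fromNat p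
  square≢prime x@(mkℚ n d-1 coprime) x²≡p
    with ℚᵘ.≃-trans (ℚᵘ.≃-sym (ℚ.toℚᵘ-homo-* x x))
           (ℚ.toℚᵘ-cong (trans (sym (x²≡x*x x)) x²≡p))
  ... | ℚᵘ.*≡* eq = square≢prime*square ℤ.∣ n ∣ (suc d-1) (recompute (coprime? _ _) coprime) (begin
    ℤ.∣ n ∣ ℕ.* ℤ.∣ n ∣                        ≡⟨ ℕ.*-identityʳ _ ⟨
    ℤ.∣ n ∣ ℕ.* ℤ.∣ n ∣ ℕ.* 1                  ≡⟨ cong (ℕ._* 1) (ℤ.abs-* n n) ⟨
    ℤ.∣ n ℤ.* n ∣ ℕ.* 1                        ≡⟨ ℤ.abs-* (n ℤ.* n) (ℤ.+ 1) ⟨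
    ℤ.∣ n ℤ.* n ℤ.* ℤ.+ 1 ∣                    ≡⟨ cong ℤ.∣_∣ eq ⟩
    ℤ.∣ ℤ.+ p ℤ.* ℤ.+ (suc d-1 ℕ.* suc d-1) ∣  ≡⟨ ℤ.abs-* (ℤ.+ p) _ ⟩
    p ℕ.* (suc d-1 ℕ.* suc d-1)                ∎)

p⊘q*q≡p : ∀ p {q} → q ≢ 0ℚ → p ⊘ q * q ≡ p
p⊘q*q≡p p {q} q≢0 with q ≟ 0ℚ
... | yes q≡0 = contradiction q≡0 q≢0
... | no  q≢0 = begin
  p * 1/ q * q    ≡⟨ ℚ.*-assoc p (1/ q) q ⟩
  p * (1/ q * q)  ≡⟨ cong (p *_) (ℚ.*-inverseˡ q) ⟩
  p * 1ℚ          ≡⟨ ℚ.*-identityʳ p ⟩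
  p               ∎
  where instance _ = ≢-nonZero q≢0

*≡⇒≡⊘ : ∀ {x p q} → q ≢ 0ℚ → x * q ≡ p → x ≡ p ⊘ q
*≡⇒≡⊘ {p = p} q≢0 eq = *-cancelʳ-≡ _ q≢0 (trans eq (sym (p⊘q*q≡p p q≢0)))

⊘-≢0 : ∀ {p q} → p ≢ 0ℚ → q ≢ 0ℚ → p ⊘ q ≢ 0ℚ
⊘-≢0 {p} {q} p≢0 q≢0 p⊘q≡0 = p≢0 (begin
  p          ≡⟨ p⊘q*q≡p p q≢0 ⟨
  p ⊘ q * q  ≡⟨ cong (_* q) p⊘q≡0 ⟩
  0ℚ * q     ≡⟨ ℚ.*-zeroˡ q ⟩
  0ℚ         ∎)

⊘≡⊘⇒*≡* : ∀ {p q p′ q′} → q ≢ 0ℚ → q′ ≢ 0ℚ → p ⊘ q ≡ p′ ⊘ q′ → p * q′ ≡ p′ * q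
⊘≡⊘⇒*≡* {p} {q} {p′} {q′} q≢0 q′≢0 eq = begin
  p * q′                ≡⟨ cong (_* q′) (p⊘q*q≡p p q≢0) ⟨
  p ⊘ q * q * q′        ≡⟨ cong (λ x → x * q * q′) eq ⟩
  p′ ⊘ q′ * q * q′      ≡⟨ ℚ.*-assoc (p′ ⊘ q′) q q′ ⟩
  p′ ⊘ q′ * (q * q′)    ≡⟨ cong (p′ ⊘ q′ *_) (ℚ.*-comm q q′) ⟩
  p′ ⊘ q′ * (q′ * q)    ≡⟨ ℚ.*-assoc (p′ ⊘ q′) q′ q ⟨
  p′ ⊘ q′ * q′ * q      ≡⟨ cong (_* q) (p⊘q*q≡p p′ q′≢0) ⟩
  p′ * q                ∎

*≡*⇒⊘≡⊘ : ∀ {p q p′ q′} → q ≢ 0ℚ → q′ ≢ 0ℚ → p * q′ ≡ p′ * q → p ⊘ q ≡ p′ ⊘ q′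
*≡*⇒⊘≡⊘ {p} {q} {p′} {q′} q≢0 q′≢0 eq = *≡⇒≡⊘ q′≢0 (*-cancelʳ-≡ q q≢0 (begin
  p ⊘ q * q′ * q    ≡⟨ ℚ.*-assoc (p ⊘ q) q′ q ⟩
  p ⊘ q * (q′ * q)  ≡⟨ cong (p ⊘ q *_) (ℚ.*-comm q′ q) ⟩
  p ⊘ q * (q * q′)  ≡⟨ ℚ.*-assoc (p ⊘ q) q q′ ⟨
  p ⊘ q * q * q′    ≡⟨ cong (_* q′) (p⊘q*q≡p p q≢0) ⟩
  p * q′            ≡⟨ eq ⟩
  p′ * q            ∎))

neg-⊘ : ∀ p q → - (p ⊘ q) ≡ (- p) ⊘ q
neg-⊘ p q with q ≟ 0ℚ
... | yes _   = refl
... | no  q≢0 = ℚ.neg-distribˡ-* p (1/ q)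
  where instance _ = ≢-nonZero q≢0

⊘*⊘ : ∀ {p q p′ q′} → q ≢ 0ℚ → q′ ≢ 0ℚ → p ⊘ q * (p′ ⊘ q′) ≡ (p * p′) ⊘ (q * q′)
⊘*⊘ {p} {q} {p′} {q′} q≢0 q′≢0 = *≡⇒≡⊘ (*-≢0 q≢0 q′≢0) (begin
  p ⊘ q * (p′ ⊘ q′) * (q * q′)  ≡⟨ interchange (p ⊘ q) (p′ ⊘ q′) q q′ ⟩
  p ⊘ q * q * (p′ ⊘ q′ * q′)    ≡⟨ cong₂ _*_ (p⊘q*q≡p p q≢0) (p⊘q*q≡p p′ q′≢0) ⟩
  p * p′                        ∎)

⊘-^ : ∀ {p q} → q ≢ 0ℚ → ∀ n → (p ⊘ q) ^ n ≡ (p ^ n) ⊘ (q ^ n)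
⊘-^         q≢0 zero    = refl
⊘-^ {p} {q} q≢0 (suc n) = trans (cong (p ⊘ q *_) (⊘-^ q≢0 n)) (⊘*⊘ q≢0 (^-≢0 n q≢0))

⊘-minus-⊘ : ∀ {p q p′ q′} → q ≢ 0ℚ → q′ ≢ 0ℚ → p ⊘ q - p′ ⊘ q′ ≡ (p * q′ - p′ * q) ⊘ (q * q′)
⊘-minus-⊘ {p} {q} {p′} {q′} q≢0 q′≢0 = *≡⇒≡⊘ (*-≢0 q≢0 q′≢0) (begin
  (p ⊘ q - p′ ⊘ q′) * (q * q′)       ≡⟨ rearrange (p ⊘ q) (p′ ⊘ q′) q q′ ⟩
  p ⊘ q * q * q′ - p′ ⊘ q′ * q′ * q  ≡⟨ cong₂ (λ x y → x * q′ - y * q) (p⊘q*q≡p p q≢0) (p⊘q*q≡p p′ q′≢0) ⟩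
  p * q′ - p′ * q                    ∎)
  where
  rearrange : ∀ x y q q′ → (x - y) * (q * q′) ≡ x * q * q′ - y * q′ * q
  rearrange = solve 4 (λ x y q q′ → (x :- y) :* (q :* q′) := x :* q :* q′ :- y :* q′ :* q) (λ {_ _ _ _} → refl)

p⊘q+1≡[p+q]⊘q : ∀ {p q} → q ≢ 0ℚ → p ⊘ q + 1ℚ ≡ (p + q) ⊘ q
p⊘q+1≡[p+q]⊘q {p} {q} q≢0 = *≡⇒≡⊘ q≢0 (begin
  (p ⊘ q + 1ℚ) * q  ≡⟨ solve 2 (λ x q → (x :+ con 1ℚ) :* q := x :* q :+ q) (λ {_ _} → refl) (p ⊘ q) q ⟩
  p ⊘ q * q + q     ≡⟨ cong (_+ q) (p⊘q*q≡p p q≢0) ⟩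
  p + q             ∎)

p⊘q-1≡[p-q]⊘q : ∀ {p q} → q ≢ 0ℚ → p ⊘ q - 1ℚ ≡ (p - q) ⊘ q
p⊘q-1≡[p-q]⊘q {p} {q} q≢0 = *≡⇒≡⊘ q≢0 (begin
  (p ⊘ q - 1ℚ) * q  ≡⟨ solve 2 (λ x q → (x :- con 1ℚ) :* q := x :* q :- q) (λ {_ _} → refl) (p ⊘ q) q ⟩
  p ⊘ q * q - q     ≡⟨ cong (_- q) (p⊘q*q≡p p q≢0) ⟩
  p - q             ∎)

square-nonNeg : ∀ x → 0ℚ ≤ x ^ 2
square-nonNeg x with ℚ.≤-total 0ℚ x
... | inj₁ 0≤x = subst (0ℚ ≤_) (sym (x²≡x*x x)) (ℚ.nonNegative⁻¹ (x * x) {{ℚ.nonNeg*nonNeg⇒nonNeg x x}})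
  where instance _ = nonNegative 0≤x
-- despite its name, ℚ.nonPos*nonPos⇒nonPos concludes NonNegative
... | inj₂ x≤0 = subst (0ℚ ≤_) (sym (x²≡x*x x)) (ℚ.nonNegative⁻¹ (x * x) {{ℚ.nonPos*nonPos⇒nonPos x x}})
  where instance _ = nonPositive x≤0

square-pos : ∀ {x} → x ≢ 0ℚ → 0ℚ < x ^ 2
square-pos {x} x≢0 with ℚ.<-cmp x 0ℚ
... | tri< x<0 _ _ = subst (0ℚ <_) (sym (x²≡x*x x)) (ℚ.positive⁻¹ (x * x) {{ℚ.neg*neg⇒pos x x}})
  where instance _ = negative x<0
... | tri≈ _ x≡0 _ = contradiction x≡0 x≢0
... | tri> _ _ 0<x = subst (0ℚ <_) (sym (x²≡x*x x)) (ℚ.positive⁻¹ (x * x) {{ℚ.pos*pos⇒pos x x}})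
  where instance _ = positive 0<x

fourth-power-pos : ∀ {x} → x ≢ 0ℚ → 0ℚ < x ^ 4
fourth-power-pos {x} x≢0 = subst (0ℚ <_) (solve 1 (λ x → (x :^ 2) :^ 2 := x :^ 4) (λ {_} → refl) x)
                             (square-pos (^-≢0 2 x≢0))

*-pos : ∀ {p q} → 0ℚ < p → 0ℚ < q → 0ℚ < p * q
*-pos {p} {q} 0<p 0<q = ℚ.positive⁻¹ (p * q) {{ℚ.pos*pos⇒pos p q}}
  where instance _ = positive 0<p
                 _ = positive 0<q

scaled-square-nonNeg : ∀ k .{{_ : NonNegative k}} x → 0ℚ ≤ k * x ^ 2
scaled-square-nonNeg k {{k≥0}} x =
  ℚ.nonNegative⁻¹ (k * x ^ 2) {{ℚ.nonNeg*nonNeg⇒nonNeg k {{k≥0}} (x ^ 2) {{nonNegative (square-nonNeg x)}}}}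

pos⇒≢0 : ∀ {p} → 0ℚ < p → p ≢ 0ℚ
pos⇒≢0 0<p = ≢-sym (ℚ.<⇒≢ 0<p)

⊘-pos : ∀ {p q} → 0ℚ < p → 0ℚ < q → 0ℚ < p ⊘ q
⊘-pos {p} {q} 0<p 0<q = ℚ.*-cancelʳ-<-nonNeg q {{nonNegative (ℚ.<⇒≤ 0<q)}}
  (subst₂ _<_ (sym (ℚ.*-zeroˡ q)) (sym (p⊘q*q≡p p (pos⇒≢0 0<q))) 0<p)

-- Ring-solver syntax for the polynomials defined below: ⟦ Syntax.f x ⟧ reduces to f ⟦ x ⟧.
module Syntax where
  P Q E F G H num-r den-r num-s den-s num-a den-a num-b den-b num-c den-c num-w :
    ∀ {n} → Polynomial n → Polynomial n
  P u = u :^ 4 :+ con 2 :* u :^ 2 :+ con 9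
  Q u = u :^ 4 :- con 2 :* u :^ 2 :+ con 9
  E u = u :^ 2 :- con 3
  F u = u :^ 8 :+ con 46 :* u :^ 4 :+ con 81
  G u = u :^ 12 :+ con 10 :* u :^ 10 :+ con 55 :* u :^ 8 :- con 52 :* u :^ 6
        :+ con 495 :* u :^ 4 :+ con 810 :* u :^ 2 :+ con 729
  H u = u :^ 8 :- con 4 :* u :^ 6 :+ con 38 :* u :^ 4 :- con 36 :* u :^ 2 :+ con 81
  num-r u = con 2 :* u
  den-r u = con 3 :- u :^ 2
  num-s u = u :^ 4 :- con 9
  den-s u = con 8 :* u :^ 2
  num-a u = P u :^ 2 :* (u :^ 2 :- con 1) :* (u :^ 2 :- con 9)
  den-a u = con 64 :* E u :^ 2 :* u :^ 4
  num-b u = con 64 :* Q u :* u :^ 4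
  den-b u = P u :^ 2 :* E u :^ 2
  num-c u = F u :* (u :^ 2 :+ con 9) :* (u :^ 2 :+ con 1) :* E u :^ 2
  den-c u = con 64 :* P u :^ 2 :* u :^ 4
  num-w u = con 2 :* u :* E u

private module S = Syntax

-- The definitions of r, s, a, c in Defs are literally x u = num-x u ⊘ den-x u, and b u = - (num-b u ⊘ den-b u).
P Q E F G H num-r den-r num-s den-s num-a den-a num-b den-b num-c den-c num-w w : ℚ → ℚ
P u = u ^ 4 + 2 * u ^ 2 + 9
Q u = u ^ 4 - 2 * u ^ 2 + 9
E u = u ^ 2 - 3
F u = u ^ 8 + 46 * u ^ 4 + 81
G u = u ^ 12 + 10 * u ^ 10 + 55 * u ^ 8 - 52 * u ^ 6 + 495 * u ^ 4 + 810 * u ^ 2 + 729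
H u = u ^ 8 - 4 * u ^ 6 + 38 * u ^ 4 - 36 * u ^ 2 + 81
num-r u = 2 * u
den-r u = 3 - u ^ 2
num-s u = u ^ 4 - 9
den-s u = 8 * u ^ 2
num-a u = P u ^ 2 * (u ^ 2 - 1) * (u ^ 2 - 9)
den-a u = 64 * E u ^ 2 * u ^ 4
num-b u = 64 * Q u * u ^ 4
den-b u = P u ^ 2 * E u ^ 2
num-c u = F u * (u ^ 2 + 9) * (u ^ 2 + 1) * E u ^ 2
den-c u = 64 * P u ^ 2 * u ^ 4
num-w u = 2 * u * E u
w u = num-w u ⊘ P u

a≡s²-r²-cleared : ∀ u → num-a u * (den-s u ^ 2 * den-r u ^ 2)
                      ≡ (num-s u ^ 2 * den-r u ^ 2 - num-r u ^ 2 * den-s u ^ 2) * den-a u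
a≡s²-r²-cleared = solve 1
  (λ u → S.num-a u :* (S.den-s u :^ 2 :* S.den-r u :^ 2)
      := (S.num-s u :^ 2 :* S.den-r u :^ 2 :- S.num-r u :^ 2 :* S.den-s u :^ 2) :* S.den-a u)
  (λ {_} → refl)

b*a≡r⁴-1-cleared : ∀ u → - num-b u * num-a u * den-r u ^ 4
                       ≡ (num-r u ^ 4 - den-r u ^ 4) * (den-b u * den-a u)
b*a≡r⁴-1-cleared = solve 1
  (λ u → :- S.num-b u :* S.num-a u :* S.den-r u :^ 4
      := (S.num-r u :^ 4 :- S.den-r u :^ 4) :* (S.den-b u :* S.den-a u))
  (λ {_} → refl)

c*a≡s⁴-1-cleared : ∀ u → num-c u * num-a u * den-s u ^ 4
                       ≡ (num-s u ^ 4 - den-s u ^ 4) * (den-c u * den-a u)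
c*a≡s⁴-1-cleared = solve 1
  (λ u → S.num-c u :* S.num-a u :* S.den-s u :^ 4
      := (S.num-s u :^ 4 :- S.den-s u :^ 4) :* (S.den-c u :* S.den-a u))
  (λ {_} → refl)

b*c+1≡w⁴-cleared : ∀ u → (- num-b u * num-c u + den-b u * den-c u) * P u ^ 4
                       ≡ num-w u ^ 4 * (den-b u * den-c u)
b*c+1≡w⁴-cleared = solve 1
  (λ u → (:- S.num-b u :* S.num-c u :+ S.den-b u :* S.den-c u) :* S.P u :^ 4
      := S.num-w u :^ 4 :* (S.den-b u :* S.den-c u))
  (λ {_} → refl)

a-b-numerator : ∀ u → num-a u * den-b u + num-b u * den-a u ≡ E u ^ 6 * G u
a-b-numerator = solve 1
  (λ u → S.num-a u :* S.den-b u :+ S.num-b u :* S.den-a u := S.E u :^ 6 :* S.G u)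
  (λ {_} → refl)

c-a-numerator : ∀ u → num-c u * den-a u - num-a u * den-c u ≡ 32768 * u ^ 10 * H u
c-a-numerator = solve 1
  (λ u → S.num-c u :* S.den-a u :- S.num-a u :* S.den-c u := con 32768 :* u :^ 10 :* S.H u)
  (λ {_} → refl)

P-sum-of-squares : ∀ u → P u ≡ (u ^ 2 + 1) ^ 2 + 8
P-sum-of-squares = solve 1 (λ u → S.P u := (u :^ 2 :+ con 1) :^ 2 :+ con 8) (λ {_} → refl)

Q-sum-of-squares : ∀ u → Q u ≡ (u ^ 2 - 1) ^ 2 + 8
Q-sum-of-squares = solve 1 (λ u → S.Q u := (u :^ 2 :- con 1) :^ 2 :+ con 8) (λ {_} → refl)

F-sum-of-squares : ∀ u → F u ≡ (u ^ 4) ^ 2 + 46 * (u ^ 2) ^ 2 + 81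
F-sum-of-squares = solve 1 (λ u → S.F u := (u :^ 4) :^ 2 :+ con 46 :* (u :^ 2) :^ 2 :+ con 81) (λ {_} → refl)

G-sum-of-squares : ∀ u → G u ≡ (u ^ 6) ^ 2 + 10 * (u ^ 5) ^ 2 + 29 * (u ^ 4) ^ 2 + 26 * (u ^ 4 - u ^ 2) ^ 2
                                + 469 * (u ^ 2) ^ 2 + 810 * u ^ 2 + 729
G-sum-of-squares = solve 1
  (λ u → S.G u := (u :^ 6) :^ 2 :+ con 10 :* (u :^ 5) :^ 2 :+ con 29 :* (u :^ 4) :^ 2
                  :+ con 26 :* (u :^ 4 :- u :^ 2) :^ 2 :+ con 469 :* (u :^ 2) :^ 2 :+ con 810 :* u :^ 2 :+ con 729)
  (λ {_} → refl)

H-sum-of-squares : ∀ u → H u ≡ (u ^ 4 - 2 * u ^ 2) ^ 2 + 18 * (u ^ 2 - 1) ^ 2 + 16 * (u ^ 2) ^ 2 + 63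
H-sum-of-squares = solve 1
  (λ u → S.H u := (u :^ 4 :- con 2 :* u :^ 2) :^ 2 :+ con 18 :* (u :^ 2 :- con 1) :^ 2
                  :+ con 16 :* (u :^ 2) :^ 2 :+ con 63)
  (λ {_} → refl)

P-pos : ∀ u → 0ℚ < P u
P-pos u = subst (0ℚ <_) (sym (P-sum-of-squares u))
  (ℚ.+-mono-≤-< (square-nonNeg (u ^ 2 + 1)) (ℚ.positive⁻¹ 8))

Q-pos : ∀ u → 0ℚ < Q u
Q-pos u = subst (0ℚ <_) (sym (Q-sum-of-squares u))
  (ℚ.+-mono-≤-< (square-nonNeg (u ^ 2 - 1)) (ℚ.positive⁻¹ 8))

F-pos : ∀ u → 0ℚ < F u
F-pos u = subst (0ℚ <_) (sym (F-sum-of-squares u))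
  (ℚ.+-mono-≤-< (ℚ.+-mono-≤ (square-nonNeg (u ^ 4)) (scaled-square-nonNeg 46 (u ^ 2))) (ℚ.positive⁻¹ 81))

G-pos : ∀ u → 0ℚ < G u
G-pos u = subst (0ℚ <_) (sym (G-sum-of-squares u))
  (ℚ.+-mono-≤-< (ℚ.+-mono-≤ (ℚ.+-mono-≤ (ℚ.+-mono-≤ (ℚ.+-mono-≤ (ℚ.+-mono-≤
    (square-nonNeg (u ^ 6))
    (scaled-square-nonNeg 10 (u ^ 5)))
    (scaled-square-nonNeg 29 (u ^ 4)))
    (scaled-square-nonNeg 26 (u ^ 4 - u ^ 2)))
    (scaled-square-nonNeg 469 (u ^ 2)))
    (scaled-square-nonNeg 810 u))
    (ℚ.positive⁻¹ 729))

H-pos : ∀ u → 0ℚ < H u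
H-pos u = subst (0ℚ <_) (sym (H-sum-of-squares u))
  (ℚ.+-mono-≤-< (ℚ.+-mono-≤ (ℚ.+-mono-≤
    (square-nonNeg (u ^ 4 - 2 * u ^ 2))
    (scaled-square-nonNeg 18 (u ^ 2 - 1)))
    (scaled-square-nonNeg 16 (u ^ 2)))
    (ℚ.positive⁻¹ 63))

P≢0 : ∀ u → P u ≢ 0ℚ
P≢0 u = pos⇒≢0 (P-pos u)

3-prime : Prime 3
3-prime = from-yes (prime? 3)

E≢0 : ∀ u → E u ≢ 0ℚ
E≢0 u = square≢prime 3-prime u ∘ p-q≡0⇒p≡q

den-r≢0 : ∀ u → den-r u ≢ 0ℚ
den-r≢0 u = square≢prime 3-prime u ∘ sym ∘ p-q≡0⇒p≡q

den-b-pos : ∀ u → 0ℚ < den-b u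
den-b-pos u = *-pos (square-pos (P≢0 u)) (square-pos (E≢0 u))

num-a≢0 : ∀ {u} → u ^ 2 ≢ 1ℚ → u ^ 2 ≢ 9 → num-a u ≢ 0ℚ
num-a≢0 {u} u²≢1 u²≢9 = *-≢0 (*-≢0 (^-≢0 2 (P≢0 u)) (u²≢1 ∘ p-q≡0⇒p≡q)) (u²≢9 ∘ p-q≡0⇒p≡q)

module Triple {u : ℚ} (u≢0 : u ≢ 0ℚ) where

  den-s≢0 : den-s u ≢ 0ℚ
  den-s≢0 = *-≢0 {8} (λ ()) (^-≢0 2 u≢0)

  den-a≢0 : den-a u ≢ 0ℚ
  den-a≢0 = *-≢0 (*-≢0 {64} (λ ()) (^-≢0 2 (E≢0 u))) (^-≢0 4 u≢0)

  den-b≢0 : den-b u ≢ 0ℚ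
  den-b≢0 = pos⇒≢0 (den-b-pos u)

  den-c-pos : 0ℚ < den-c u
  den-c-pos = *-pos (*-pos (ℚ.positive⁻¹ 64) (square-pos (P≢0 u))) (fourth-power-pos u≢0)

  den-c≢0 : den-c u ≢ 0ℚ
  den-c≢0 = pos⇒≢0 den-c-pos

  num-b-pos : 0ℚ < num-b u
  num-b-pos = *-pos (*-pos (ℚ.positive⁻¹ 64) (Q-pos u)) (fourth-power-pos u≢0)

  num-c-pos : 0ℚ < num-c u
  num-c-pos = *-pos (*-pos (*-pos (F-pos u) (u²+k-pos 9)) (u²+k-pos 1)) (square-pos (E≢0 u))
    where
    u²+k-pos : ∀ k .{{_ : Positive k}} → 0ℚ < u ^ 2 + k
    u²+k-pos k = ℚ.+-mono-≤-< (square-nonNeg u) (ℚ.positive⁻¹ k)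

  a≡s²-r² : a u ≡ s u ^ 2 - r u ^ 2
  a≡s²-r² = begin
    num-a u ⊘ den-a u
      ≡⟨ *≡*⇒⊘≡⊘ den-a≢0 (*-≢0 (^-≢0 2 den-s≢0) (^-≢0 2 (den-r≢0 u))) (a≡s²-r²-cleared u) ⟩
    (num-s u ^ 2 * den-r u ^ 2 - num-r u ^ 2 * den-s u ^ 2) ⊘ (den-s u ^ 2 * den-r u ^ 2)
      ≡⟨ ⊘-minus-⊘ (^-≢0 2 den-s≢0) (^-≢0 2 (den-r≢0 u)) ⟨
    num-s u ^ 2 ⊘ den-s u ^ 2 - num-r u ^ 2 ⊘ den-r u ^ 2
      ≡⟨ cong₂ _-_ (⊘-^ den-s≢0 2) (⊘-^ (den-r≢0 u) 2) ⟨
    s u ^ 2 - r u ^ 2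
      ∎

  b*a≡r⁴-1 : b u * a u ≡ r u ^ 4 - 1ℚ
  b*a≡r⁴-1 = begin
    - (num-b u ⊘ den-b u) * (num-a u ⊘ den-a u)
      ≡⟨ cong (_* a u) (neg-⊘ (num-b u) (den-b u)) ⟩
    (- num-b u) ⊘ den-b u * (num-a u ⊘ den-a u)
      ≡⟨ ⊘*⊘ den-b≢0 den-a≢0 ⟩
    (- num-b u * num-a u) ⊘ (den-b u * den-a u)
      ≡⟨ *≡*⇒⊘≡⊘ (*-≢0 den-b≢0 den-a≢0) (^-≢0 4 (den-r≢0 u)) (b*a≡r⁴-1-cleared u) ⟩
    (num-r u ^ 4 - den-r u ^ 4) ⊘ den-r u ^ 4
      ≡⟨ p⊘q-1≡[p-q]⊘q (^-≢0 4 (den-r≢0 u)) ⟨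
    num-r u ^ 4 ⊘ den-r u ^ 4 - 1ℚ
      ≡⟨ cong (_- 1ℚ) (⊘-^ (den-r≢0 u) 4) ⟨
    r u ^ 4 - 1ℚ
      ∎

  c*a≡s⁴-1 : c u * a u ≡ s u ^ 4 - 1ℚ
  c*a≡s⁴-1 = begin
    num-c u ⊘ den-c u * (num-a u ⊘ den-a u)
      ≡⟨ ⊘*⊘ den-c≢0 den-a≢0 ⟩
    (num-c u * num-a u) ⊘ (den-c u * den-a u)
      ≡⟨ *≡*⇒⊘≡⊘ (*-≢0 den-c≢0 den-a≢0) (^-≢0 4 den-s≢0) (c*a≡s⁴-1-cleared u) ⟩
    (num-s u ^ 4 - den-s u ^ 4) ⊘ den-s u ^ 4
      ≡⟨ p⊘q-1≡[p-q]⊘q (^-≢0 4 den-s≢0) ⟨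
    num-s u ^ 4 ⊘ den-s u ^ 4 - 1ℚ
      ≡⟨ cong (_- 1ℚ) (⊘-^ den-s≢0 4) ⟨
    s u ^ 4 - 1ℚ
      ∎

  b*c+1≡w⁴ : b u * c u + 1ℚ ≡ w u ^ 4
  b*c+1≡w⁴ = begin
    - (num-b u ⊘ den-b u) * (num-c u ⊘ den-c u) + 1ℚ
      ≡⟨ cong (λ x → x * c u + 1ℚ) (neg-⊘ (num-b u) (den-b u)) ⟩
    (- num-b u) ⊘ den-b u * (num-c u ⊘ den-c u) + 1ℚ
      ≡⟨ cong (_+ 1ℚ) (⊘*⊘ den-b≢0 den-c≢0) ⟩
    (- num-b u * num-c u) ⊘ (den-b u * den-c u) + 1ℚ
      ≡⟨ p⊘q+1≡[p+q]⊘q (*-≢0 den-b≢0 den-c≢0) ⟩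
    (- num-b u * num-c u + den-b u * den-c u) ⊘ (den-b u * den-c u)
      ≡⟨ *≡*⇒⊘≡⊘ (*-≢0 den-b≢0 den-c≢0) (^-≢0 4 (P≢0 u)) (b*c+1≡w⁴-cleared u) ⟩
    num-w u ^ 4 ⊘ P u ^ 4
      ≡⟨ ⊘-^ (P≢0 u) 4 ⟨
    w u ^ 4
      ∎

  a*b+1≡r⁴ : a u * b u + 1ℚ ≡ r u ^ 4
  a*b+1≡r⁴ = p≡q-1⇒p+1≡q (trans (ℚ.*-comm (a u) (b u)) b*a≡r⁴-1)

  a*c+1≡s⁴ : a u * c u + 1ℚ ≡ s u ^ 4
  a*c+1≡s⁴ = p≡q-1⇒p+1≡q (trans (ℚ.*-comm (a u) (c u)) c*a≡s⁴-1)

  b<0 : b u < 0ℚ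
  b<0 = ℚ.neg-antimono-< (⊘-pos num-b-pos (den-b-pos u))

  0<c : 0ℚ < c u
  0<c = ⊘-pos num-c-pos den-c-pos

  a≢b : a u ≢ b u
  a≢b a≡b = *-≢0 (^-≢0 6 (E≢0 u)) (pos⇒≢0 (G-pos u)) (begin
    E u ^ 6 * G u                              ≡⟨ a-b-numerator u ⟨
    num-a u * den-b u + num-b u * den-a u      ≡⟨ cong (_+ num-b u * den-a u) cross ⟩
    (- num-b u) * den-a u + num-b u * den-a u  ≡⟨ cong (_+ num-b u * den-a u) (ℚ.neg-distribˡ-* (num-b u) (den-a u)) ⟨
    - (num-b u * den-a u) + num-b u * den-a u  ≡⟨ ℚ.+-inverseˡ (num-b u * den-a u) ⟩
    0ℚ                                         ∎)
    where
    cross : num-a u * den-b u ≡ (- num-b u) * den-a u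
    cross = ⊘≡⊘⇒*≡* den-a≢0 den-b≢0 (trans a≡b (neg-⊘ (num-b u) (den-b u)))

  a≢c : a u ≢ c u
  a≢c a≡c = *-≢0 (*-≢0 {32768} (λ ()) (^-≢0 10 u≢0)) (pos⇒≢0 (H-pos u)) (begin
    32768 * u ^ 10 * H u                   ≡⟨ c-a-numerator u ⟨
    num-c u * den-a u - num-a u * den-c u  ≡⟨ cong (_- num-a u * den-c u) cross ⟩
    num-a u * den-c u - num-a u * den-c u  ≡⟨ ℚ.+-inverseʳ (num-a u * den-c u) ⟩
    0ℚ                                     ∎)
    where
    cross : num-c u * den-a u ≡ num-a u * den-c u
    cross = ⊘≡⊘⇒*≡* den-c≢0 den-a≢0 (sym a≡c)

mainTheorem8 : (u : ℚ) → u ≢ 0ℚ → u ≢ 1 → u ≢ -1 → u ≢ 3 → u ≢ -3 →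
    (a u ≡ s u ^ 2 - r u ^ 2) ×
    (b u ≡ (r u ^ 4 - 1) ⊘ a u) ×
    (c u ≡ (s u ^ 4 - 1) ⊘ a u) ×
    QuarticDiophantineTriple (a u) (b u) (c u)
mainTheorem8 u u≢0 u≢1 u≢-1 u≢3 u≢-3 =
    a≡s²-r²
  , *≡⇒≡⊘ a≢0 b*a≡r⁴-1
  , *≡⇒≡⊘ a≢0 c*a≡s⁴-1
  , (a≢b , a≢c , ℚ.<⇒≢ (ℚ.<-trans b<0 0<c))
  , (a≢0 , ℚ.<⇒≢ b<0 , pos⇒≢0 0<c)
  , (r u , a*b+1≡r⁴) , (s u , a*c+1≡s⁴) , (w u , b*c+1≡w⁴)
  where
  open Triple u≢0

  a≢0 : a u ≢ 0ℚ
  a≢0 = ⊘-≢0 (num-a≢0 {u} u²≢1 u²≢9) den-a≢0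
    where
    u²≢1 : u ^ 2 ≢ 1ℚ
    u²≢1 = [ u≢1 , u≢-1 ]′ ∘ x²≡y²⇒x≡±y {y = 1ℚ}
    u²≢9 : u ^ 2 ≢ 9
    u²≢9 = [ u≢3 , u≢-3 ]′ ∘ x²≡y²⇒x≡±y {y = 3}
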